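{- In the Slow Flashcard Game, for all $n\ge 1$ we have $T_1(n)\le n^2-n+1$.
   Context: The Slow Flashcard Game is the following deterministic process with insertion sequence $p_k=k+1$. The state at each time $t=1,2,\dots$ consists of an ordering (the deck) of all positive integers (cards), positions numbered $1,2,\dots$ from the front, together with a counter for each card recording how many times it has been seen. At time $t=1$ the deck is $1,2,3,\dots$, card $1$ (at the front) has been seen once, and all other cards $0$ times. To pass from time $t$ to $t+1$: if the front card has been seen $k$ times so far, remove it and reinsert it so that it occupies position $k+1$; then the card now at the front has its counter increased by one (it is seen at time $t+1$). For $n,k\ge1$, $T_n(k)$ denotes the time at which card $n$ is seen for the $k$-th time. -}

module Defs where

open import Data.Nat using (ℕ; zero; suc; _+_; _∸_; _<ᵇ_; _≡ᵇ_)
open import Data.Bool using (if_then_else_)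
open import Data.Product using (_×_; _,_; proj₁; proj₂)
open import Relation.Binary.PropositionalEquality using (_≡_)

-- A deck: position (0-indexed, position 0 = front) ↦ card (a positive integer).
Deck : Set
Deck = ℕ → ℕ

-- A counter: card ↦ number of times seen so far.
Counter : Set
Counter = ℕ → ℕ

State : Set
State = Deck × Counter

-- Remove the front card and reinsert it so that it occupies (1-indexed)
-- position k+1, i.e. 0-indexed position k.
reinsert : ℕ → Deck → Deck
reinsert k d i =
  if i <ᵇ k then d (suc i)
  else if i ≡ᵇ k then d 0
  else d i

bump : ℕ → Counter → Counter
bump c cnt m = if m ≡ᵇ c then suc (cnt m) else cnt m

-- One step of the Slow Flashcard Game (insertion sequence p_k = k + 1).
step : State → State
step (d , cnt) =
  let d' = reinsert (cnt (d 0)) d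
  in d' , bump (d' 0) cnt

initial : State
initial = (λ i → suc i) , (λ m → if m ≡ᵇ 1 then 1 else 0)

-- stateAfter s = state at time s + 1.
stateAfter : ℕ → State
stateAfter zero = initial
stateAfter (suc s) = step (stateAfter s)

-- State at time t (for t ≥ 1; time 0 is not used).
stateAt : ℕ → State
stateAt t = stateAfter (t ∸ 1)

-- Card n is seen for the k-th time at time t (t ≥ 1), i.e. T_n(k) = t:
-- at time t card n is at the front and its counter equals k.
SeenAt : ℕ → ℕ → ℕ → Set
SeenAt n k t = (proj₁ (stateAt t) 0 ≡ n) × (proj₂ (stateAt t) n ≡ k)

-- Let N be the number of times card 1 has been seen.  Reinsertion never moves
-- card 1 past position N, and every card strictly between the front and card 1
-- has been seen fewer than N times; hence a card other than 1 that reaches the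
-- front has been seen fewer than N times, and no card is ever seen more often
-- than card 1.  Only cards 1, …, N+1 can have reached the front, so the current
-- time is at most N + N·N.  At time m² + m + 1 this forces N ≥ m + 1, and since
-- the count of card 1 rises by one exactly when card 1 is seen, card 1 was seen
-- for the (m+1)-th time no later than m² + m + 1 = n² − n + 1.
module Submission where

open import Defs
open import Data.Bool using (true; false; if_then_else_)
open import Data.Nat using (ℕ; zero; suc; _+_; _*_; _∸_; _≤_; _<_; _<ᵇ_; _≡ᵇ_; z≤n; s≤s; z<s; s<s)
open import Data.Nat.Properties
open import Data.Product using (_×_; _,_; ∃-syntax; proj₁; proj₂)
open import Data.Sum using (_⊎_; inj₁; inj₂)
open import Function using (_∘_)
open import Relation.Binary.PropositionalEquality
open import Relation.Nullary using (¬_; contradiction; yes; no)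
open import Relation.Nullary.Reflects using (Reflects; ofʸ; ofⁿ; fromEquivalence)

≡ᵇ-reflects-≡ : ∀ m n → Reflects (m ≡ n) (m ≡ᵇ n)
≡ᵇ-reflects-≡ m n = fromEquivalence (≡ᵇ⇒≡ m n) (≡⇒≡ᵇ m n)

origin : ℕ → ℕ → ℕ
origin k i = if i <ᵇ k then suc i else if i ≡ᵇ k then 0 else i

reinsert-origin : ∀ k (d : Deck) i → reinsert k d i ≡ d (origin k i)
reinsert-origin k d i with i <ᵇ k
... | true = refl
... | false with i ≡ᵇ k
...   | true = refl
...   | false = refl

data OriginView (k i : ℕ) : ℕ → Set where
  before : i < k → OriginView k i (suc i)
  at     : i ≡ k → OriginView k i 0
  after  : k < i → OriginView k i i

origin-view : ∀ k i → OriginView k i (origin k i)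
origin-view k i with i <ᵇ k | <ᵇ-reflects-< i k
... | true  | ofʸ i<k = before i<k
... | false | ofⁿ i≮k with i ≡ᵇ k | ≡ᵇ-reflects-≡ i k
...   | true  | ofʸ i≡k = at i≡k
...   | false | ofⁿ i≢k = after (≤∧≢⇒< (≮⇒≥ i≮k) (λ k≡i → i≢k (sym k≡i)))

origin-injective : ∀ k {i j} → origin k i ≡ origin k j → i ≡ j
origin-injective k {i} {j} e with origin k i | origin-view k i | origin k j | origin-view k j
origin-injective k e    | _ | before _   | _ | before _   = suc-injective e
origin-injective k ()   | _ | before _   | _ | at _
origin-injective k refl | _ | before i<k | _ | after k<j  = contradiction (≤-pred k<j) (<⇒≱ i<k)
origin-injective k ()   | _ | at _       | _ | before _
origin-injective k e    | _ | at i≡k     | _ | at j≡k     = trans i≡k (sym j≡k)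
origin-injective k refl | _ | at _       | _ | after k<j  = contradiction k<j (λ ())
origin-injective k refl | _ | after k<i  | _ | before j<k = contradiction (≤-pred k<i) (<⇒≱ j<k)
origin-injective k refl | _ | after k<i  | _ | at _       = contradiction k<i (λ ())
origin-injective k e    | _ | after _    | _ | after _    = e

origin-≤ : ∀ {k i B} → k ≤ B → i ≤ B → origin k i ≤ B
origin-≤ {k} {i} k≤B i≤B with origin k i | origin-view k i
... | _ | before i<k = ≤-trans i<k k≤B
... | _ | at _       = z≤n
... | _ | after _    = i≤B

origin-< : ∀ {k i} → i < k → origin k i ≡ suc i
origin-< {k} {i} i<k with origin k i | origin-view k i
... | _ | before _  = refl
... | _ | at i≡k    = contradiction i≡k (<⇒≢ i<k)
... | _ | after k<i = contradiction k<i (<⇒≯ i<k)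

origin-self : ∀ k → origin k k ≡ 0
origin-self k with origin k k | origin-view k k
... | _ | before k<k = contradiction k<k (<-irrefl refl)
... | _ | at _       = refl
... | _ | after k<k  = contradiction k<k (<-irrefl refl)

origin-fixes-> : ∀ {k i} → k < i → origin k i ≡ i
origin-fixes-> {k} {i} k<i with origin k i | origin-view k i
... | _ | before i<k = contradiction k<i (<⇒≯ i<k)
... | _ | at i≡k     = contradiction (sym i≡k) (<⇒≢ k<i)
... | _ | after _    = refl

record DeckShape (B : ℕ) (d : Deck) : Set where
  field
    injective : ∀ {i j} → d i ≡ d j → i ≡ j
    positive  : ∀ i → d i ≢ 0
    head      : ∀ i → i ≤ B → d i ≤ suc B
    tail      : ∀ i → B < i → d i ≡ suc i

reinsert-shape : ∀ {k B d} → k ≤ B → DeckShape B d → DeckShape B (reinsert k d)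
reinsert-shape {k} {B} {d} k≤B S = record
  { injective = λ {i} {j} e → origin-injective k (injective (trans (sym (via i)) (trans e (via j))))
  ; positive  = λ i → positive (origin k i) ∘ trans (sym (via i))
  ; head      = λ i i≤B → subst (_≤ suc B) (sym (via i)) (head (origin k i) (origin-≤ k≤B i≤B))
  ; tail      = λ i B<i → trans (via i) (trans (cong d (origin-fixes-> (≤-<-trans k≤B B<i))) (tail i B<i))
  }
  where
  open DeckShape S
  via : ∀ i → reinsert k d i ≡ d (origin k i)
  via = reinsert-origin k d

shape-suc : ∀ {B d} → DeckShape B d → DeckShape (suc B) d
shape-suc {B} {d} S = record
  { injective = injective
  ; positive  = positive
  ; head      = head′
  ; tail      = λ i B+1<i → tail i (<-trans (n<1+n B) B+1<i)
  }
  where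
  open DeckShape S
  head′ : ∀ i → i ≤ suc B → d i ≤ suc (suc B)
  head′ i i≤B+1 with m≤n⇒m<n∨m≡n i≤B+1
  ... | inj₁ i<B+1 = m≤n⇒m≤1+n (head i (≤-pred i<B+1))
  ... | inj₂ refl  = ≤-reflexive (tail (suc B) (n<1+n B))

position-of-1-bound : ∀ {B d p} → DeckShape B d → d p ≡ 1 → p ≤ B
position-of-1-bound {B} {d} {p} S dp≡1 = ≮⇒≥ λ B<p →
  contradiction (subst (B <_) (suc-injective (trans (sym (tail p B<p)) dp≡1)) B<p) (λ ())
  where open DeckShape S

bump-≡ : ∀ {c m} (cnt : Counter) → m ≡ c → bump c cnt m ≡ suc (cnt m)
bump-≡ {c} {m} cnt m≡c with m ≡ᵇ c | ≡ᵇ-reflects-≡ m c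
... | true  | _        = refl
... | false | ofⁿ m≢c = contradiction m≡c m≢c

bump-≢ : ∀ {c m} (cnt : Counter) → m ≢ c → bump c cnt m ≡ cnt m
bump-≢ {c} {m} cnt m≢c with m ≡ᵇ c | ≡ᵇ-reflects-≡ m c
... | true  | ofʸ m≡c = contradiction m≡c m≢c
... | false | _       = refl

sumBelow : ℕ → Counter → ℕ
sumBelow zero    f = 0
sumBelow (suc M) f = sumBelow M f + f M

sumBelow-cong : ∀ M {f g : Counter} → (∀ i → i < M → f i ≡ g i) → sumBelow M f ≡ sumBelow M g
sumBelow-cong zero    f≗g = refl
sumBelow-cong (suc M) f≗g =
  cong₂ _+_ (sumBelow-cong M (λ i i<M → f≗g i (m<n⇒m<1+n i<M))) (f≗g M (n<1+n M))

sumBelow-bump : ∀ M {c} (cnt : Counter) → c < M →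
                sumBelow M (bump c cnt) ≡ suc (sumBelow M cnt)
sumBelow-bump (suc M) {c} cnt c<1+M with m≤n⇒m<n∨m≡n (≤-pred c<1+M)
... | inj₁ c<M  = cong₂ _+_ (sumBelow-bump M cnt c<M) (bump-≢ cnt (>⇒≢ c<M))
... | inj₂ refl = begin
  sumBelow M (bump M cnt) + bump M cnt M  ≡⟨ cong (_+ bump M cnt M) (sumBelow-cong M (λ i i<M → bump-≢ cnt (<⇒≢ i<M))) ⟩
  sumBelow M cnt + bump M cnt M           ≡⟨ cong (sumBelow M cnt +_) (bump-≡ cnt refl) ⟩
  sumBelow M cnt + suc (cnt M)            ≡⟨ +-suc _ _ ⟩
  suc (sumBelow M cnt + cnt M)            ∎
  where open ≡-Reasoning

sumBelow-bound : ∀ m (f : Counter) {b} → (∀ i → 2 ≤ i → i < 2 + m → f i ≤ b) →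
                 sumBelow (2 + m) f ≤ f 0 + f 1 + m * b
sumBelow-bound zero    f f≤b = ≤-reflexive (sym (+-identityʳ _))
sumBelow-bound (suc m) f {b} f≤b = begin
  sumBelow (2 + m) f + f (2 + m)  ≤⟨ +-mono-≤ (sumBelow-bound m f f≤b′) (f≤b (2 + m) (s≤s (s≤s z≤n)) ≤-refl) ⟩
  f 0 + f 1 + m * b + b           ≡⟨ +-assoc (f 0 + f 1) (m * b) b ⟩
  f 0 + f 1 + (m * b + b)         ≡⟨ cong (f 0 + f 1 +_) (+-comm (m * b) b) ⟩
  f 0 + f 1 + suc m * b           ∎
  where
  open ≤-Reasoning
  f≤b′ : ∀ i → 2 ≤ i → i < 2 + m → f i ≤ b
  f≤b′ i 2≤i i<2+m = f≤b i 2≤i (m<n⇒m<1+n i<2+m)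

record Invariant (t N : ℕ) (d : Deck) (cnt : Counter) : Set where
  field
    shape            : DeckShape N d
    count-1          : cnt 1 ≡ N
    count-≤          : ∀ c → c ≢ 1 → cnt c ≤ N
    pos-1            : ℕ
    deck-pos-1       : d pos-1 ≡ 1
    count-ahead-<    : ∀ i → 0 < i → i < pos-1 → cnt (d i) < N
    count-<-at-front : pos-1 ≡ 0 → ∀ c → c ≢ 1 → cnt c < N
    count-0          : cnt 0 ≡ 0
    sum-counts       : ∀ M → suc N < M → sumBelow M cnt ≡ t

module Step {t N d cnt} (I : Invariant t N d cnt) where
  open Invariant I
  open DeckShape shape

  k : ℕ
  k = cnt (d 0)

  d′ : Deck
  d′ = reinsert k d

  front′ : ℕ
  front′ = d′ 0

  cnt′ : Counter
  cnt′ = bump front′ cnt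

  k≤N : k ≤ N
  k≤N with d 0 ≟ 1
  ... | yes d0≡1 = ≤-reflexive (trans (cong cnt d0≡1) count-1)
  ... | no  d0≢1 = count-≤ (d 0) d0≢1

  shape′ : DeckShape N d′
  shape′ = reinsert-shape k≤N shape

  front′≢0 : front′ ≢ 0
  front′≢0 = DeckShape.positive shape′ 0

  count-0′ : cnt′ 0 ≡ 0
  count-0′ = trans (bump-≢ cnt (≢-sym front′≢0)) count-0

  sum-counts′ : ∀ M → suc N < M → sumBelow M cnt′ ≡ suc t
  sum-counts′ M 1+N<M =
    trans (sumBelow-bump M cnt (≤-<-trans (DeckShape.head shape′ 0 z≤n) 1+N<M)) (cong suc (sum-counts M 1+N<M))

  CountsBefore-< : ℕ → Set
  CountsBefore-< p = ∀ i → i < p → cnt (d′ i) < N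

  deck′-< : ∀ {i} → i < k → d′ i ≡ d (suc i)
  deck′-< i<k = trans (reinsert-origin k d _) (cong d (origin-< i<k))

  card-1-after-reinsert : ∀ p → d p ≡ 1 →
                          (∀ i → 0 < i → i < p → cnt (d i) < N) →
                          (p ≡ 0 → ∀ c → c ≢ 1 → cnt c < N) →
                          ∃[ p′ ] d′ p′ ≡ 1 × CountsBefore-< p′
  card-1-after-reinsert zero d0≡1 _ at-front =
    k , trans (reinsert-origin k d k) (trans (cong d (origin-self k)) d0≡1) , behind-k
    where
    behind-k : CountsBefore-< k
    behind-k i i<k rewrite deck′-< i<k =
      at-front refl (d (suc i)) (λ e → 1+n≢0 (injective (trans e (sym d0≡1))))
  card-1-after-reinsert p@(suc q) dp≡1 ahead _ with k <? p
  ... | yes k<p = p , trans (reinsert-origin k d p) (trans (cong d (origin-fixes-> k<p)) dp≡1) , ahead′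
    where
    ahead′ : CountsBefore-< p
    ahead′ i i<p rewrite reinsert-origin k d i with origin k i | origin-view k i
    ... | _ | before i<k = ahead (suc i) z<s (≤-<-trans i<k k<p)
    ... | _ | at _       = <-≤-trans k<p (position-of-1-bound shape dp≡1)
    ... | _ | after k<i  = ahead i (≤-<-trans z≤n k<i) i<p
  ... | no k≮p = q , trans (deck′-< (≮⇒≥ k≮p)) dp≡1 , ahead′
    where
    ahead′ : CountsBefore-< q
    ahead′ i i<q rewrite deck′-< (<-≤-trans i<q (<⇒≤ (≮⇒≥ k≮p))) =
      ahead (suc i) z<s (s<s i<q)

  seen-1 : front′ ≡ 1 → Invariant (suc t) (suc N) d′ cnt′
  seen-1 front′≡1 = record
    { shape            = shape-suc shape′
    ; count-1          = trans (bump-≡ cnt (sym front′≡1)) (cong suc count-1)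
    ; count-≤          = λ c c≢1 → m≤n⇒m≤1+n (count′-≤ c c≢1)
    ; pos-1            = 0
    ; deck-pos-1       = front′≡1
    ; count-ahead-<    = λ _ _ ()
    ; count-<-at-front = λ _ c c≢1 → s≤s (count′-≤ c c≢1)
    ; count-0          = count-0′
    ; sum-counts       = λ M 2+N<M → sum-counts′ M (<-trans (n<1+n (suc N)) 2+N<M)
    }
    where
    count′-≤ : ∀ c → c ≢ 1 → cnt′ c ≤ N
    count′-≤ c c≢1 =
      subst (_≤ N) (sym (bump-≢ cnt (λ c≡f → c≢1 (trans c≡f front′≡1)))) (count-≤ c c≢1)

  unseen-1 : front′ ≢ 1 → Invariant (suc t) N d′ cnt′
  unseen-1 front′≢1 with card-1-after-reinsert pos-1 deck-pos-1 count-ahead-< count-<-at-front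
  ... | p , d′p≡1 , ahead = record
    { shape            = shape′
    ; count-1          = trans (bump-≢ cnt (≢-sym front′≢1)) count-1
    ; count-≤          = count-≤′
    ; pos-1            = p
    ; deck-pos-1       = d′p≡1
    ; count-ahead-<    = λ i 0<i i<p → subst (_< N) (sym (bump-≢ cnt (0<i⇒≢front′ 0<i))) (ahead i i<p)
    ; count-<-at-front = λ p≡0 → contradiction p≡0 p≢0
    ; count-0          = count-0′
    ; sum-counts       = sum-counts′
    }
    where
    p≢0 : p ≢ 0
    p≢0 p≡0 = front′≢1 (trans (cong d′ (sym p≡0)) d′p≡1)
    0<i⇒≢front′ : ∀ {i} → 0 < i → d′ i ≢ front′
    0<i⇒≢front′ 0<i e = <⇒≢ 0<i (sym (DeckShape.injective shape′ e))
    count-≤′ : ∀ c → c ≢ 1 → cnt′ c ≤ N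
    count-≤′ c c≢1 with c ≟ front′
    ... | yes refl = subst (_≤ N) (sym (bump-≡ cnt refl)) (ahead 0 (n≢0⇒n>0 p≢0))
    ... | no  c≢f  = subst (_≤ N) (sym (bump-≢ cnt c≢f)) (count-≤ c c≢1)

step-invariant : ∀ {t N d cnt} → Invariant t N d cnt →
                 ∃[ N′ ] Invariant (suc t) N′ (proj₁ (step (d , cnt))) (proj₂ (step (d , cnt)))
step-invariant I with Step.front′ I ≟ 1
... | yes front′≡1 = _ , Step.seen-1 I front′≡1
... | no  front′≢1 = _ , Step.unseen-1 I front′≢1

initial-invariant : Invariant 1 1 (proj₁ initial) (proj₂ initial)
initial-invariant = record
  { shape            = record
    { injective = suc-injective
    ; positive  = λ _ ()
    ; head      = λ _ → s≤s
    ; tail      = λ _ _ → refl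
    }
  ; count-1          = refl
  ; count-≤          = λ c c≢1 → m≤n⇒m≤1+n (≤-reflexive (count-unseen c c≢1))
  ; pos-1            = 0
  ; deck-pos-1       = refl
  ; count-ahead-<    = λ _ _ ()
  ; count-<-at-front = λ _ c c≢1 → s≤s (≤-reflexive (count-unseen c c≢1))
  ; count-0          = refl
  ; sum-counts       = sum-counts₀
  }
  where
  count-unseen : ∀ c → c ≢ 1 → proj₂ initial c ≡ 0
  count-unseen zero          _   = refl
  count-unseen (suc zero)    c≢1 = contradiction refl c≢1
  count-unseen (suc (suc c)) _   = refl
  sum-counts₀ : ∀ M → 2 < M → sumBelow M (proj₂ initial) ≡ 1
  sum-counts₀ (suc zero)             (s≤s ())
  sum-counts₀ (suc (suc zero))       (s≤s (s≤s ()))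
  sum-counts₀ (suc (suc (suc zero))) _ = refl
  sum-counts₀ (suc M@(suc (suc (suc _)))) _ =
    trans (+-identityʳ _) (sum-counts₀ M (s≤s (s≤s (s≤s z≤n))))

deckAfter : ℕ → Deck
deckAfter s = proj₁ (stateAfter s)

countsAfter : ℕ → Counter
countsAfter s = proj₂ (stateAfter s)

reachable-invariant : ∀ s → ∃[ N ] Invariant (suc s) N (deckAfter s) (countsAfter s)
reachable-invariant zero    = 1 , initial-invariant
reachable-invariant (suc s) = step-invariant (proj₂ (reachable-invariant s))

time-bound : ∀ {t N d cnt} → Invariant t N d cnt → t ≤ N + N * N
time-bound {t} {N} {d} {cnt} I = begin
  t                             ≡⟨ sum-counts (2 + N) ≤-refl ⟨
  sumBelow (2 + N) cnt          ≤⟨ sumBelow-bound N cnt (λ i 2≤i _ → count-≤ i (>⇒≢ 2≤i)) ⟩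
  cnt 0 + cnt 1 + N * N         ≡⟨ cong₂ (λ a b → a + b + N * N) count-0 count-1 ⟩
  N + N * N                     ∎
  where
  open Invariant I
  open ≤-Reasoning

count-1-step : ∀ s → countsAfter (suc s) 1 ≡ countsAfter s 1
                   ⊎ countsAfter (suc s) 1 ≡ suc (countsAfter s 1) × deckAfter (suc s) 0 ≡ 1
count-1-step s with deckAfter (suc s) 0 ≟ 1
... | yes front≡1 = inj₂ (bump-≡ (countsAfter s) (sym front≡1) , front≡1)
... | no  front≢1 = inj₁ (bump-≢ (countsAfter s) (≢-sym front≢1))

card-1-seen-at-each-count : ∀ s n → 1 ≤ n → n ≤ countsAfter s 1 →
                            ∃[ s′ ] s′ ≤ s × deckAfter s′ 0 ≡ 1 × countsAfter s′ 1 ≡ n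
card-1-seen-at-each-count zero    (suc zero) _ _ = 0 , z≤n , refl , refl
card-1-seen-at-each-count zero    (suc (suc n)) _ (s≤s ())
card-1-seen-at-each-count (suc s) n 1≤n n≤count with n ≤? countsAfter s 1
... | yes n≤count′ with card-1-seen-at-each-count s n 1≤n n≤count′
...   | s′ , s′≤s , front , count = s′ , m≤n⇒m≤1+n s′≤s , front , count
card-1-seen-at-each-count (suc s) n 1≤n n≤count | no n≰count′ with count-1-step s
... | inj₁ same = contradiction (subst (n ≤_) same n≤count) n≰count′
... | inj₂ (grown , front) =
  suc s , ≤-refl , front , ≤-antisym (subst (_≤ n) (sym grown) (≰⇒> n≰count′)) n≤count

count-1-reaches : ∀ m → suc m ≤ countsAfter (m + m * m) 1
count-1-reaches m with reachable-invariant (m + m * m)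
... | N , I = subst (suc m ≤_) (sym (Invariant.count-1 I)) (≮⇒≥ N≯m)
  where
  N≯m : ¬ N < suc m
  N≯m N<1+m = <-irrefl refl (<-≤-trans (time-bound I) (+-mono-≤ N≤m (*-mono-≤ N≤m N≤m)))
    where N≤m = ≤-pred N<1+m

square-∸-self-+1 : ∀ m → suc m * suc m ∸ suc m + 1 ≡ suc (m + m * m)
square-∸-self-+1 m = begin
  suc m * suc m ∸ suc m + 1  ≡⟨ cong (_+ 1) (m+n∸m≡n (suc m) (m * suc m)) ⟩
  m * suc m + 1              ≡⟨ cong (_+ 1) (*-suc m m) ⟩
  m + m * m + 1              ≡⟨ +-comm (m + m * m) 1 ⟩
  suc (m + m * m)            ∎
  where open ≡-Reasoning

mainTheorem4 : (n : ℕ) → 1 ≤ n →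
    ∃[ t ] (1 ≤ t × t ≤ n * n ∸ n + 1 × SeenAt 1 n t)
mainTheorem4 zero    ()
mainTheorem4 (suc m) 1≤n with card-1-seen-at-each-count (m + m * m) (suc m) 1≤n (count-1-reaches m)
... | s , s≤m+m² , front , count =
  suc s , s≤s z≤n , subst (suc s ≤_) (sym (square-∸-self-+1 m)) (s≤s s≤m+m²) , front , count
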